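{- For every positive integer $n\equiv 0\pmod 3$ there exist two totally symmetric Latin squares of order $n$ that are isotopic but not isomorphic.
   Context: A Latin square of order $n$ is a set of $n^2$ triples (row, column, symbol) over an $n$-element set used to index rows, columns and symbols, distinct triples agreeing in at most one coordinate. It is totally symmetric if it is unchanged by every uniform permutation of the three coordinates of its triples. An isotopism $(\alpha,\beta,\gamma)$ of permutations of the index set maps $(r,c,s)$ to $(r^\alpha,c^\beta,s^\gamma)$; an isomorphism is an isotopism with $\alpha=\beta=\gamma$. -}

module Defs where

open import Data.Nat using (ℕ; _*_)
open import Data.Fin using (Fin)
open import Data.Bool using (Bool; true)
open import Data.Product using (_×_; _,_; Σ; ∃)
open import Data.List using (List; length; filterᵇ; allFin; cartesianProduct)
open import Data.Fin.Permutation using (Permutation′; _⟨$⟩ʳ_)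
open import Relation.Binary.PropositionalEquality using (_≡_)
open import Relation.Nullary using (¬_)

Triple : ℕ → Set
Triple n = Fin n × Fin n × Fin n

-- A set of triples over Fin n (row, column, symbol), as a decidable subset.
TripleSet : ℕ → Set
TripleSet n = Triple n → Bool

_∈T_ : ∀ {n} → Triple n → TripleSet n → Set
t ∈T L = L t ≡ true

allTriples : ∀ n → List (Triple n)
allTriples n = cartesianProduct (allFin n) (cartesianProduct (allFin n) (allFin n))

size : ∀ {n} → TripleSet n → ℕ
size {n} L = length (filterᵇ L (allTriples n))

AgreeInTwo : ∀ {n} → Triple n → Triple n → Set
AgreeInTwo (r , c , s) (r′ , c′ , s′) =
  ((r ≡ r′) × (c ≡ c′)) ⊎′ (((r ≡ r′) × (s ≡ s′)) ⊎′ ((c ≡ c′) × (s ≡ s′)))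
  where open import Data.Sum renaming (_⊎_ to _⊎′_)

IsLatinSquare : ∀ {n} → TripleSet n → Set
IsLatinSquare {n} L =
  (size L ≡ n * n) ×
  (∀ t t′ → t ∈T L → t′ ∈T L → ¬ (t ≡ t′) → ¬ AgreeInTwo t t′)

IsTotallySymmetric : ∀ {n} → TripleSet n → Set
IsTotallySymmetric L =
  ∀ r c s →
    (L (r , c , s) ≡ L (r , s , c)) ×
    (L (r , c , s) ≡ L (c , r , s)) ×
    (L (r , c , s) ≡ L (c , s , r)) ×
    (L (r , c , s) ≡ L (s , r , c)) ×
    (L (r , c , s) ≡ L (s , c , r))

IsIsotopism : ∀ {n} → Permutation′ n → Permutation′ n → Permutation′ n →
              TripleSet n → TripleSet n → Set
IsIsotopism α β γ L₁ L₂ =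
  ∀ r c s → L₂ (α ⟨$⟩ʳ r , β ⟨$⟩ʳ c , γ ⟨$⟩ʳ s) ≡ L₁ (r , c , s)

Isotopic : ∀ {n} → TripleSet n → TripleSet n → Set
Isotopic {n} L₁ L₂ =
  Σ (Permutation′ n) λ α → Σ (Permutation′ n) λ β → Σ (Permutation′ n) λ γ →
    IsIsotopism α β γ L₁ L₂

Isomorphic : ∀ {n} → TripleSet n → TripleSet n → Set
Isomorphic {n} L₁ L₂ = Σ (Permutation′ n) λ α → IsIsotopism α α α L₁ L₂

-- Take L_k = {(r, c, s) : r + c + s + k ≡ 0 (mod n)} over ℤ/n. The sum is symmetric in
-- the three coordinates and determines any coordinate from the other two, so each L_k is
-- a totally symmetric Latin square. Shifting symbols by one is an isotopism from L_n = L_0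
-- onto L_{n-1}. An isomorphism α from L_0 would send (0,0,0) to a diagonal triple (a,a,a)
-- of L_{n-1}, so 3a + n - 1 ≡ 0 (mod n); when 3 ∣ n this forces 3 ∣ n - 1, which is absurd.
module Submission where

open import Defs
open import Data.Nat using (ℕ; _<_)
open import Data.Nat.Divisibility using (_∣_)
open import Data.Product using (Σ; _×_)
open import Relation.Nullary using (¬_)

open import Data.Bool using (Bool; true; false; T; T?)
open import Data.Bool.Properties using (T-≡)
open import Data.Fin using (Fin; zero; suc; toℕ; fromℕ<)
open import Data.Fin.Properties using (toℕ-injective; toℕ<n; toℕ-fromℕ<; suc-injective)
open import Data.Fin.Permutation as Permutation using (Permutation′; _⟨$⟩ʳ_; permutation)
open import Data.List using (List; []; _∷_; _++_; length; filterᵇ; allFin; tabulate; map; cartesianProduct)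
open import Data.List.Properties using (filter-++; filter-none; length-++; length-tabulate)
open import Data.List.Relation.Unary.All.Properties using (tabulate⁺)
open import Data.Nat using (suc; _+_; _*_)
open import Data.Nat.DivMod using (_%_; %-distribˡ-+; m%n%n≡m%n; [m+kn]%n≡m%n; m<n⇒m%n≡m; %-remove-+ˡ; %-remove-+ʳ; m%n<n)
open import Data.Nat.Divisibility using (_∣?_; m%n≡0⇒n∣m; n∣m⇒m%n≡0; m∣m*n; ∣m+n∣m⇒∣n; ∣-trans; ∣-refl; ∣1⇒≡1)
open import Data.Nat.Properties using (+-comm; +-assoc; *-identityʳ; +-commutativeSemigroup)
open import Algebra.Properties.CommutativeSemigroup +-commutativeSemigroup
  using (xy∙z≈xz∙y; xy∙z≈yx∙z; xy∙z≈yz∙x)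
open import Data.Nat.Tactic.RingSolver using (solve-∀)
open import Data.Product using (_,_; proj₁; proj₂; ∃!)
open import Data.Sum using (inj₁; inj₂)
open import Function using (_∘_; id; _⇔_; mk⇔; Equivalence)
open import Relation.Nullary using (Dec; does)
open import Relation.Nullary.Decidable using (yes; dec-true; does-⇔)
open import Relation.Binary.PropositionalEquality
  using (_≡_; refl; sym; trans; cong; cong₂; subst; module ≡-Reasoning)

open ≡-Reasoning

does≡true⇔ : ∀ {A : Set} (a? : Dec A) → does a? ≡ true ⇔ A
does≡true⇔ a? = mk⇔ (witness a?) (dec-true a?)
  where
  witness : ∀ {A : Set} (a? : Dec A) → does a? ≡ true → A
  witness (yes a) _ = a

length-filterᵇ-map : ∀ {A B : Set} (P : B → Bool) (f : A → B) (xs : List A) →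
  length (filterᵇ P (map f xs)) ≡ length (filterᵇ (P ∘ f) xs)
length-filterᵇ-map P f []       = refl
length-filterᵇ-map P f (x ∷ xs) with P (f x)
... | true  = cong suc (length-filterᵇ-map P f xs)
... | false = length-filterᵇ-map P f xs

length-filterᵇ-cartesianProduct : ∀ {A B : Set} {k} (P : A × B → Bool) (xs : List A) (ys : List B) →
  (∀ x → length (filterᵇ (λ y → P (x , y)) ys) ≡ k) →
  length (filterᵇ P (cartesianProduct xs ys)) ≡ length xs * k
length-filterᵇ-cartesianProduct         P []       ys fibre = refl
length-filterᵇ-cartesianProduct {k = k} P (x ∷ xs) ys fibre = begin
  length (filterᵇ P (map (x ,_) ys ++ cartesianProduct xs ys))
    ≡⟨ cong length (filter-++ (T? ∘ P) (map (x ,_) ys) _) ⟩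
  length (filterᵇ P (map (x ,_) ys) ++ filterᵇ P (cartesianProduct xs ys))
    ≡⟨ length-++ (filterᵇ P (map (x ,_) ys)) ⟩
  length (filterᵇ P (map (x ,_) ys)) + length (filterᵇ P (cartesianProduct xs ys))
    ≡⟨ cong₂ _+_ (trans (length-filterᵇ-map P (x ,_) ys) (fibre x))
                 (length-filterᵇ-cartesianProduct P xs ys fibre) ⟩
  k + length xs * k ∎

length-filterᵇ-tabulate-∃! : ∀ {A : Set} {n} (P : A → Bool) (f : Fin n → A) →
  ∃! _≡_ (λ i → P (f i) ≡ true) → length (filterᵇ P (tabulate f)) ≡ 1
length-filterᵇ-tabulate-∃! {n = suc n} P f (zero , P[f0] , unique) rewrite P[f0] =
  cong (suc ∘ length) (filter-none (T? ∘ P) (tabulate⁺ rejected))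
  where
  rejected : ∀ i → ¬ T (P (f (suc i)))
  rejected i t with () ← unique (Equivalence.to T-≡ t)
length-filterᵇ-tabulate-∃! {n = suc n} P f (suc i , P[fi] , unique) with P (f zero) in P[f0]
... | true  with () ← unique P[f0]
... | false = length-filterᵇ-tabulate-∃! P (f ∘ suc) (i , P[fi] , suc-injective ∘ unique)

IsOperationTable : ∀ {n} → TripleSet n → Set
IsOperationTable L = ∀ r c → ∃! _≡_ λ s → (r , c , s) ∈T L

module _ {n : ℕ} {L : TripleSet n} where

  size-operationTable : IsOperationTable L → size L ≡ n * n
  size-operationTable table =
    trans (length-filterᵇ-cartesianProduct L (allFin n) _ row) (cong (_* n) (length-tabulate {n = n} id))
    where
    cell : ∀ r c → length (filterᵇ (λ s → L (r , c , s)) (allFin n)) ≡ 1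
    cell r c = length-filterᵇ-tabulate-∃! (λ s → L (r , c , s)) id (table r c)
    row : ∀ r → length (filterᵇ (λ cs → L (r , cs)) (cartesianProduct (allFin n) (allFin n))) ≡ n
    row r = begin
      length (filterᵇ (λ cs → L (r , cs)) (cartesianProduct (allFin n) (allFin n)))
        ≡⟨ length-filterᵇ-cartesianProduct _ (allFin n) (allFin n) (cell r) ⟩
      length (allFin n) * 1 ≡⟨ *-identityʳ _ ⟩
      length (allFin n)     ≡⟨ length-tabulate id ⟩
      n                     ∎

  isTotallySymmetric-from-swap-cycle : (∀ r c s → L (r , c , s) ≡ L (c , r , s)) →
                                       (∀ r c s → L (r , c , s) ≡ L (c , s , r)) →
                                       IsTotallySymmetric L
  isTotallySymmetric-from-swap-cycle swap cycle r c s =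
    trans cycle² (swap s r c) , swap r c s , cycle r c s , cycle² , trans (cycle r c s) (swap c s r)
    where
    cycle² : L (r , c , s) ≡ L (s , r , c)
    cycle² = trans (cycle r c s) (cycle c s r)

  symmetricOperationTable⇒isLatinSquare : IsTotallySymmetric L → IsOperationTable L → IsLatinSquare L
  symmetricOperationTable⇒isLatinSquare symmetric table = size-operationTable table , distinct⇒¬agree
    where
    third-unique : ∀ {r c s s′} → (r , c , s) ∈T L → (r , c , s′) ∈T L → s ≡ s′
    third-unique {r} {c} t t′ with _ , _ , unique ← table r c = trans (sym (unique t)) (unique t′)
    [r,s,c]∈L : ∀ {r c s} → (r , c , s) ∈T L → (r , s , c) ∈T L
    [r,s,c]∈L {r} {c} {s} t = trans (sym (proj₁ (symmetric r c s))) t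
    [c,s,r]∈L : ∀ {r c s} → (r , c , s) ∈T L → (c , s , r) ∈T L
    [c,s,r]∈L {r} {c} {s} t = trans (sym (proj₁ (proj₂ (proj₂ (symmetric r c s))))) t
    distinct⇒¬agree : ∀ t t′ → t ∈T L → t′ ∈T L → ¬ (t ≡ t′) → ¬ AgreeInTwo t t′
    distinct⇒¬agree _ _ t t′ t≢t′ (inj₁ (refl , refl)) =
      t≢t′ (cong (λ s → _ , _ , s) (third-unique t t′))
    distinct⇒¬agree _ _ t t′ t≢t′ (inj₂ (inj₁ (refl , refl))) =
      t≢t′ (cong (λ c → _ , c , _) (third-unique ([r,s,c]∈L t) ([r,s,c]∈L t′)))
    distinct⇒¬agree _ _ t t′ t≢t′ (inj₂ (inj₂ (refl , refl))) =
      t≢t′ (cong (λ r → r , _ , _) (third-unique ([c,s,r]∈L t) ([c,s,r]∈L t′)))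

module SumSquares (m : ℕ) where

  n : ℕ
  n = suc m

  [a+b%n]%n≡[a+b]%n : ∀ a b → (a + b % n) % n ≡ (a + b) % n
  [a+b%n]%n≡[a+b]%n a b = begin
    (a + b % n) % n             ≡⟨ %-distribˡ-+ a (b % n) n ⟩
    (a % n + b % n % n) % n     ≡⟨ cong (λ v → (a % n + v) % n) (m%n%n≡m%n b n) ⟩
    (a % n + b % n) % n         ≡⟨ sym (%-distribˡ-+ a b n) ⟩
    (a + b) % n                 ∎

  %≡%⇒∣⇔∣ : ∀ {a b} → a % n ≡ b % n → n ∣ a ⇔ n ∣ b
  %≡%⇒∣⇔∣ {a} {b} a≡b = mk⇔
    (λ n∣a → m%n≡0⇒n∣m b n (trans (sym a≡b) (n∣m⇒m%n≡0 a n n∣a)))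
    (λ n∣b → m%n≡0⇒n∣m a n (trans a≡b (n∣m⇒m%n≡0 b n n∣b)))

  -- The residue of -a modulo n, because a + m * a = n * a.
  negate : ℕ → ℕ
  negate a = (m * a) % n

  ∣+⇔≡negate : ∀ a z → z < n → n ∣ a + z ⇔ z ≡ negate a
  ∣+⇔≡negate a z z<n = mk⇔ solution-is-negate negate-is-solution
    where
    solution-is-negate : n ∣ a + z → z ≡ negate a
    solution-is-negate n∣a+z = begin
      z                     ≡⟨ sym (m<n⇒m%n≡m z<n) ⟩
      z % n                 ≡⟨ sym ([m+kn]%n≡m%n z a n) ⟩
      (z + a * n) % n       ≡⟨ cong (_% n) (rearrange z a m) ⟩
      (m * a + (a + z)) % n ≡⟨ %-remove-+ʳ (m * a) n∣a+z ⟩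
      (m * a) % n           ∎
      where
      rearrange : ∀ z a m → z + a * suc m ≡ m * a + (a + z)
      rearrange = solve-∀
    negate-is-solution : z ≡ negate a → n ∣ a + z
    negate-is-solution refl =
      Equivalence.from (%≡%⇒∣⇔∣ ([a+b%n]%n≡[a+b]%n a (m * a))) (m∣m*n a)

  rotate : ℕ → Fin n → Fin n
  rotate j i = fromℕ< (m%n<n (j + toℕ i) n)

  rotate-cancel : ∀ {a b} → n ∣ a + b → ∀ i → rotate a (rotate b i) ≡ i
  rotate-cancel {a} {b} n∣a+b i = toℕ-injective (begin
    toℕ (rotate a (rotate b i))     ≡⟨ toℕ-fromℕ< _ ⟩
    (a + toℕ (rotate b i)) % n      ≡⟨ cong (λ v → (a + v) % n) (toℕ-fromℕ< _) ⟩
    (a + (b + toℕ i) % n) % n       ≡⟨ [a+b%n]%n≡[a+b]%n a (b + toℕ i) ⟩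
    (a + (b + toℕ i)) % n           ≡⟨ cong (_% n) (sym (+-assoc a b (toℕ i))) ⟩
    (a + b + toℕ i) % n             ≡⟨ %-remove-+ˡ (toℕ i) n∣a+b ⟩
    toℕ i % n                       ≡⟨ m<n⇒m%n≡m (toℕ<n i) ⟩
    toℕ i                           ∎)

  rotation : ℕ → Permutation′ n
  rotation j = permutation (rotate j) (rotate (m * j))
    (rotate-cancel {j} {m * j} (m∣m*n j))
    (rotate-cancel {m * j} {j} (subst (n ∣_) (+-comm j (m * j)) (m∣m*n j)))

  sumSquare : ℕ → TripleSet n
  sumSquare k (r , c , s) = does (n ∣? toℕ r + toℕ c + toℕ s + k)

  ∈sumSquare⇔ : ∀ k r c s → (r , c , s) ∈T sumSquare k ⇔ toℕ s ≡ negate (toℕ r + toℕ c + k)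
  ∈sumSquare⇔ k r c s = mk⇔
    (Equivalence.to solution ∘ subst (n ∣_) regroup ∘ Equivalence.to member)
    (Equivalence.from member ∘ subst (n ∣_) (sym regroup) ∘ Equivalence.from solution)
    where
    member : (r , c , s) ∈T sumSquare k ⇔ n ∣ toℕ r + toℕ c + toℕ s + k
    member = does≡true⇔ (n ∣? toℕ r + toℕ c + toℕ s + k)
    solution : n ∣ toℕ r + toℕ c + k + toℕ s ⇔ toℕ s ≡ negate (toℕ r + toℕ c + k)
    solution = ∣+⇔≡negate (toℕ r + toℕ c + k) (toℕ s) (toℕ<n s)
    regroup : toℕ r + toℕ c + toℕ s + k ≡ toℕ r + toℕ c + k + toℕ s
    regroup = xy∙z≈xz∙y (toℕ r + toℕ c) (toℕ s) k

  sumSquare-isOperationTable : ∀ k → IsOperationTable (sumSquare k)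
  sumSquare-isOperationTable k r c = w , Equivalence.from (∈sumSquare⇔ k r c w) (toℕ-fromℕ< _) ,
    λ {s} t → toℕ-injective (trans (toℕ-fromℕ< _) (sym (Equivalence.to (∈sumSquare⇔ k r c s) t)))
    where
    w : Fin n
    w = fromℕ< (m%n<n (m * (toℕ r + toℕ c + k)) n)

  sumSquare-isTotallySymmetric : ∀ k → IsTotallySymmetric (sumSquare k)
  sumSquare-isTotallySymmetric k = isTotallySymmetric-from-swap-cycle
    (λ r c s → cong (λ v → does (n ∣? v + k)) (xy∙z≈yx∙z (toℕ r) (toℕ c) (toℕ s)))
    (λ r c s → cong (λ v → does (n ∣? v + k)) (xy∙z≈yz∙x (toℕ r) (toℕ c) (toℕ s)))

  sumSquare-isLatinSquare : ∀ k → IsLatinSquare (sumSquare k)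
  sumSquare-isLatinSquare k =
    symmetricOperationTable⇒isLatinSquare (sumSquare-isTotallySymmetric k) (sumSquare-isOperationTable k)

  sumSquare-rotation-isotopism : ∀ j k →
    IsIsotopism Permutation.id Permutation.id (rotation j) (sumSquare (j + k)) (sumSquare k)
  sumSquare-rotation-isotopism j k r c s =
    does-⇔ (%≡%⇒∣⇔∣ {a + b + toℕ (rotate j s) + k} {a + b + d + (j + k)} residues) (n ∣? _) (n ∣? _)
    where
    a b d : ℕ
    a = toℕ r
    b = toℕ c
    d = toℕ s
    rearrange : ∀ a b d j k → a + b + k + (j + d) ≡ a + b + d + (j + k)
    rearrange = solve-∀
    residues : (a + b + toℕ (rotate j s) + k) % n ≡ (a + b + d + (j + k)) % n
    residues = begin
      (a + b + toℕ (rotate j s) + k) % n ≡⟨ cong (λ v → (a + b + v + k) % n) (toℕ-fromℕ< _) ⟩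
      (a + b + (j + d) % n + k) % n     ≡⟨ cong (_% n) (xy∙z≈xz∙y (a + b) ((j + d) % n) k) ⟩
      (a + b + k + (j + d) % n) % n     ≡⟨ [a+b%n]%n≡[a+b]%n (a + b + k) (j + d) ⟩
      (a + b + k + (j + d)) % n         ≡⟨ cong (_% n) (rearrange a b d j k) ⟩
      (a + b + d + (j + k)) % n         ∎

  sumSquare-¬isomorphic : ∀ {k k′} → 3 ∣ n → n ∣ k → ¬ 3 ∣ k′ →
                          ¬ Isomorphic (sumSquare k) (sumSquare k′)
  sumSquare-¬isomorphic {k} {k′} 3∣n n∣k 3∤k′ (α , isomorphism) =
    3∤k′ (∣m+n∣m⇒∣n 3∣3a+k′ (m∣m*n a))
    where
    a : ℕ
    a = toℕ (α ⟨$⟩ʳ zero)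
    diagonal : (α ⟨$⟩ʳ zero , α ⟨$⟩ʳ zero , α ⟨$⟩ʳ zero) ∈T sumSquare k′
    diagonal = trans (isomorphism zero zero zero) (dec-true (n ∣? k) n∣k)
    triple : ∀ a k → a + a + a + k ≡ 3 * a + k
    triple = solve-∀
    3∣3a+k′ : 3 ∣ 3 * a + k′
    3∣3a+k′ = ∣-trans 3∣n (subst (n ∣_) (triple a k′) (Equivalence.to (does≡true⇔ (n ∣? _)) diagonal))

lemma16 : (n : ℕ) → 0 < n → 3 ∣ n →
    Σ (TripleSet n) λ L₁ → Σ (TripleSet n) λ L₂ →
      (IsLatinSquare L₁ × IsTotallySymmetric L₁) ×
      (IsLatinSquare L₂ × IsTotallySymmetric L₂) ×
      Isotopic L₁ L₂ × ¬ Isomorphic L₁ L₂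
lemma16 (suc m) _ 3∣n =
  sumSquare n , sumSquare m ,
  (sumSquare-isLatinSquare n , sumSquare-isTotallySymmetric n) ,
  (sumSquare-isLatinSquare m , sumSquare-isTotallySymmetric m) ,
  (Permutation.id , Permutation.id , rotation 1 , sumSquare-rotation-isotopism 1 m) ,
  sumSquare-¬isomorphic 3∣n ∣-refl 3∤m
  where
  open SumSquares m
  3∤m : ¬ 3 ∣ m
  3∤m 3∣m with () ← ∣1⇒≡1 (∣m+n∣m⇒∣n (subst (3 ∣_) (+-comm 1 m) 3∣n) 3∣m)
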